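{- Let $R=\{(0,0),(0,1),(0,2),(1,0),(2,0)\}$. Then $(123,R)\sim_d(132,R)$.
   Context: $S_n$ denotes the set of permutations of $[n]=\{1,\dots,n\}$, written $\pi=\pi_1\cdots\pi_n$. A mesh pattern of length $k$ is a pair $(\tau,R)$ with $\tau\in S_k$ and $R\subseteq\{0,1,\dots,k\}^2$ (the shaded boxes; box $(a,b)$ is the unit square $[a,a+1]\times[b,b+1]$ in the diagram of $\tau$). An occurrence of $(\tau,R)$ in $\pi\in S_n$ is a choice of indices $i_1<\dots<i_k$ such that $\pi_{i_1}\cdots\pi_{i_k}$ is order-isomorphic to $\tau$ and, with $i_0=0$, $i_{k+1}=n+1$, $v_1<\dots<v_k$ the values $\pi_{i_1},\dots,\pi_{i_k}$ sorted increasingly, $v_0=0$, $v_{k+1}=n+1$, for every $(a,b)\in R$ there is no index $m$ with $i_a<m<i_{a+1}$ and $v_b<\pi_m<v_{b+1}$. Mesh patterns $p,q$ are equidistributed, $p\sim_d q$, if for all $n,\ell\ge0$ the number of $\pi\in S_n$ with exactly $\ell$ occurrences of $p$ equals the number with exactly $\ell$ occurrences of $q$. -}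

module Defs where

open import Data.Nat using (ℕ; zero; suc; _<ᵇ_; _≡ᵇ_)
open import Data.Bool using (Bool; true; false; _∧_; not; if_then_else_) renaming (_≟_ to _Bool≟_)
open import Data.Fin using (Fin; toℕ; zero; suc)
open import Data.Vec using (Vec; []; _∷_; lookup; toList)
open import Data.List using (List; []; _∷_; map; concatMap; filter; length; allFin)
open import Data.Product using (_×_; _,_)
open import Relation.Binary.PropositionalEquality using (_≡_)

allB : ∀ {A : Set} → (A → Bool) → List A → Bool
allB p []       = true
allB p (x ∷ xs) = p x ∧ allB p xs

anyB : ∀ {A : Set} → (A → Bool) → List A → Bool
anyB p []       = false
anyB p (x ∷ xs) = if p x then true else anyB p xs

allVecs : (n k : ℕ) → List (Vec (Fin n) k)
allVecs n zero    = [] ∷ []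
allVecs n (suc k) = concatMap (λ x → map (x ∷_) (allVecs n k)) (allFin n)

distinct : ∀ {n k} → Vec (Fin n) k → Bool
distinct []       = true
distinct (x ∷ xs) = allB (λ y → not (toℕ x ≡ᵇ toℕ y)) (toList xs) ∧ distinct xs

-- S_n : a permutation π = π₁⋯πₙ of [n] is a vector of length n over Fin n
-- (value πᵢ is represented by toℕ (lookup π (i-1)) + 1) with distinct entries.
IsPerm : ∀ {n} → Vec (Fin n) n → Bool
IsPerm = distinct

-- A mesh pattern (τ , R) of length k: τ is a permutation of [k]
-- (represented like above, 0-based), R a list of shaded boxes (a , b).
record MeshPattern : Set where
  constructor mesh
  field
    len    : ℕ
    τ      : Vec (Fin len) len
    shaded : List (ℕ × ℕ)

insert : ℕ → List ℕ → List ℕ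
insert x []       = x ∷ []
insert x (y ∷ ys) = if x <ᵇ y then x ∷ y ∷ ys else y ∷ insert x ys

sort : List ℕ → List ℕ
sort []       = []
sort (x ∷ xs) = insert x (sort xs)

nth : ℕ → List ℕ → ℕ → ℕ
nth d []       _       = d
nth d (x ∷ xs) zero    = x
nth d (x ∷ xs) (suc j) = nth d xs j

-- Is the choice of (0-based) positions `is` an occurrence of the mesh pattern p in π?
-- Positions / values below are the 1-based ones of the paper.
IsOccurrence : ∀ {n} (p : MeshPattern) → Vec (Fin n) n → Vec (Fin n) (MeshPattern.len p) → Bool
IsOccurrence {n} (mesh k τ R) π is =
  increasing ∧ orderIso ∧ allB box R
  where
    idx : List ℕ
    idx = map (λ i → suc (toℕ i)) (toList is)
    val : Fin n → ℕ
    val m = suc (toℕ (lookup π m))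
    vals : List ℕ
    vals = map val (toList is)
    increasing : Bool
    increasing = allB (λ a → allB (λ b → not (toℕ a <ᵇ toℕ b) ∨' (toℕ (lookup is a) <ᵇ toℕ (lookup is b))) (allFin k)) (allFin k)
      where
        _∨'_ : Bool → Bool → Bool
        true ∨' _ = true
        false ∨' y = y
    orderIso : Bool
    orderIso = allB (λ a → allB (λ b →
                 ((val (lookup is a) <ᵇ val (lookup is b)) ≡ᵇᵇ (toℕ (lookup τ a) <ᵇ toℕ (lookup τ b))))
                 (allFin k)) (allFin k)
      where
        _≡ᵇᵇ_ : Bool → Bool → Bool
        true  ≡ᵇᵇ y = y
        false ≡ᵇᵇ y = not y
    -- i_a for a ∈ {0,…,k+1}, with i₀ = 0, i_{k+1} = n+1
    iB : ℕ → ℕ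
    iB zero    = 0
    iB (suc a) = nth (suc n) idx a
    -- v_b for b ∈ {0,…,k+1}: sorted values, v₀ = 0, v_{k+1} = n+1
    vB : ℕ → ℕ
    vB zero    = 0
    vB (suc b) = nth (suc n) (sort vals) b
    box : ℕ × ℕ → Bool
    box (a , b) = not (anyB (λ m → (iB a <ᵇ suc (toℕ m)) ∧ (suc (toℕ m) <ᵇ iB (suc a))
                                 ∧ (vB b <ᵇ val m) ∧ (val m <ᵇ vB (suc b))) (allFin n))

occ : ∀ {n} → MeshPattern → Vec (Fin n) n → ℕ
occ {n} p π = length (filter (λ is → IsOccurrence p π is Bool≟ true) (allVecs n (MeshPattern.len p)))

countPerms : MeshPattern → ℕ → ℕ → ℕ
countPerms p n ℓ =
  length (filter (λ π → (IsPerm π ∧ (occ p π ≡ᵇ ℓ)) Bool≟ true) (allVecs n n))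

_∼d_ : MeshPattern → MeshPattern → Set
p ∼d q = ∀ (n ℓ : ℕ) → countPerms p n ℓ ≡ countPerms q n ℓ

τ123 : Vec (Fin 3) 3
τ123 = zero ∷ suc zero ∷ suc (suc zero) ∷ []
τ132 : Vec (Fin 3) 3
τ132 = zero ∷ suc (suc zero) ∷ suc zero ∷ []

R₃₁ : List (ℕ × ℕ)
R₃₁ = (0 , 0) ∷ (0 , 1) ∷ (0 , 2) ∷ (1 , 0) ∷ (2 , 0) ∷ []

-- The shading R says that at an occurrence a < b < c (0-based positions) of 123 or
-- 132 in π, the entry π a is a left-to-right minimum, no left-to-right minimum lies
-- in (a, c], and every entry left of a exceeds both π b and π c.  So b and c lie in the
-- gap between π a and the next left-to-right minimum.  Reversing the contents of every
-- such gap preserves the left-to-right minima and is therefore an involution of S_n,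
-- and it maps the occurrences (a, b, c) of 123 in π bijectively onto the occurrences
-- (a, r c, r b) of 132 in the image, where r reflects each position within its gap.
-- Counting through these two involutions gives the equidistribution.

module Submission where

open import Defs
open import Algebra.Definitions using (Involutive)
open import Data.Bool using (Bool; true; false; _∧_; not) renaming (_≟_ to _Bool≟_)
open import Data.Bool.Properties using (∧-conicalˡ; ∧-conicalʳ; not-injective; T-≡; ⇔→≡)
open import Data.Empty using (⊥; ⊥-elim)
open import Data.Fin using (Fin; toℕ; fromℕ<)
open import Data.Fin.Properties using (toℕ-fromℕ<; toℕ<n; toℕ-injective)
open import Data.List using (List; []; _∷_; map; filter; length; allFin; concatMap; _++_; cartesianProductWith)
open import Data.List.Membership.Propositional using (_∈_)
open import Data.List.Membership.Propositional.Properties using (∈-allFin; ∈-map⁺; ∈-cartesianProductWith⁺)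
open import Data.List.Membership.Propositional.Properties.WithK using (unique∧set⇒bag)
open import Data.List.Relation.Binary.BagAndSetEquality using (∼bag⇒↭)
open import Data.List.Relation.Binary.Permutation.Propositional using (_↭_)
open import Data.List.Relation.Binary.Permutation.Propositional.Properties using (↭-length; filter-↭)
open import Data.List.Relation.Unary.All using (All; []; _∷_)
open import Data.List.Relation.Unary.AllPairs using ([]; _∷_)
open import Data.List.Relation.Unary.Any using (here; there)
open import Data.List.Relation.Unary.Unique.Propositional using (Unique)
open import Data.List.Relation.Unary.Unique.Propositional.Properties
  using (allFin⁺; cartesianProductWith⁺) renaming (map⁺ to Unique-map⁺)
open import Data.Nat
open import Data.Nat.Properties
open import Data.Product using (_×_; _,_; proj₁; proj₂; swap; ∃-syntax)
open import Data.Sum using (inj₁; inj₂; [_,_]′)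
open import Data.Vec using (Vec; []; _∷_; lookup; toList; tabulate)
open import Data.Vec.Properties using (∷-injective; lookup∘tabulate; tabulate∘lookup; tabulate-cong)
open import Function using (case_of_; id; _∘_)
open import Function.Bundles using (_⇔_; mk⇔; Equivalence)
open import Relation.Binary.Definitions using (tri<; tri≈; tri>)
open import Relation.Binary.PropositionalEquality
open import Relation.Nullary using (¬_; Dec; yes; no; contradiction)
open import Relation.Unary using (Decidable)

count : {A : Set} → (A → Bool) → List A → ℕ
count P xs = length (filter (λ x → P x Bool≟ true) xs)

allVecs-suc : ∀ n k → allVecs n (suc k) ≡ cartesianProductWith _∷_ (allFin n) (allVecs n k)
allVecs-suc n k = go (allFin n)
  where
    go : (xs : List (Fin n)) →
         concatMap (λ x → map (x ∷_) (allVecs n k)) xs ≡ cartesianProductWith _∷_ xs (allVecs n k)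
    go []       = refl
    go (x ∷ xs) = cong (map (x ∷_) (allVecs n k) ++_) (go xs)

allVecs-unique : ∀ n k → Unique (allVecs n k)
allVecs-unique n zero    = [] ∷ []
allVecs-unique n (suc k) rewrite allVecs-suc n k =
  cartesianProductWith⁺ _∷_ ∷-injective (allFin⁺ n) (allVecs-unique n k)

allVecs-complete : ∀ {n k} (v : Vec (Fin n) k) → v ∈ allVecs n k
allVecs-complete []                = here refl
allVecs-complete {n} {suc k} (x ∷ v) rewrite allVecs-suc n k =
  ∈-cartesianProductWith⁺ _∷_ (∈-allFin x) (allVecs-complete v)

map-involution-↭ : ∀ {n k} {g : Vec (Fin n) k → Vec (Fin n) k} →
                   Involutive _≡_ g → map g (allVecs n k) ↭ allVecs n k
map-involution-↭ {n} {k} {g} g∘g≗id =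
  ∼bag⇒↭ (unique∧set⇒bag (Unique-map⁺ g-injective (allVecs-unique n k)) (allVecs-unique n k)
           (λ {v} → mk⇔ (λ _ → allVecs-complete v) (λ _ → g-covers v)))
  where
    g-injective : ∀ {u v} → g u ≡ g v → u ≡ v
    g-injective {u} {v} gu≡gv = trans (sym (g∘g≗id u)) (trans (cong g gu≡gv) (g∘g≗id v))
    g-covers : ∀ v → v ∈ map g (allVecs n k)
    g-covers v = subst (_∈ map g (allVecs n k)) (g∘g≗id v) (∈-map⁺ g (allVecs-complete (g v)))

count-map : {A B : Set} {P : A → Bool} {Q : B → Bool} (g : A → B) →
            (∀ x → P x ≡ Q (g x)) → ∀ xs → count P xs ≡ count Q (map g xs)
count-map g P≗Q∘g []       = refl
count-map {Q = Q} g P≗Q∘g (x ∷ xs) rewrite P≗Q∘g x with Q (g x)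
... | true  = cong suc (count-map g P≗Q∘g xs)
... | false = count-map g P≗Q∘g xs

count-involution : ∀ {n k} {P Q : Vec (Fin n) k → Bool} (g : Vec (Fin n) k → Vec (Fin n) k) →
                   Involutive _≡_ g → (∀ v → P v ≡ Q (g v)) →
                   count P (allVecs n k) ≡ count Q (allVecs n k)
count-involution {n} {k} {Q = Q} g g∘g≗id P≗Q∘g =
  trans (count-map g P≗Q∘g (allVecs n k))
        (↭-length (filter-↭ (λ v → Q v Bool≟ true) (map-involution-↭ g∘g≗id)))

mirror : ℕ → ℕ → ℕ → ℕ
mirror a e k = a + e ∸ k

mirror-inside : ∀ {a e k} → a < k → k < e → a < mirror a e k × mirror a e k < e
mirror-inside {a} {e} {k} a<k k<e =
  subst (a <_) (sym (+-∸-assoc a (<⇒≤ k<e))) (m<m+n a (m<n⇒0<n∸m k<e)) ,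
  subst (mirror a e k <_) (m+n∸m≡n k e) (∸-monoˡ-< (+-monoˡ-< e a<k) (≤-trans (<⇒≤ k<e) (m≤n+m e a)))

mirror-involutive : ∀ {a e k} → k ≤ a + e → mirror a e (mirror a e k) ≡ k
mirror-involutive = m∸[m∸n]≡n

mirror-antitone : ∀ {a e b c} → b < c → c ≤ a + e → mirror a e c < mirror a e b
mirror-antitone = ∸-monoʳ-<

-- C marks cut positions, 0 among them; reflect reverses every gap strictly between
-- consecutive cuts, the last gap ending at n.
module GapReversal {C : ℕ → Set} (C? : Decidable C) (C0 : C 0) (n : ℕ) where

  lastCut : ℕ → ℕ
  lastCut zero = zero
  lastCut (suc k) with C? (suc k)
  ... | yes _ = suc k
  ... | no  _ = lastCut k

  lastCut-≤ : ∀ k → lastCut k ≤ k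
  lastCut-≤ zero = z≤n
  lastCut-≤ (suc k) with C? (suc k)
  ... | yes _ = ≤-refl
  ... | no  _ = m≤n⇒m≤1+n (lastCut-≤ k)

  lastCut-cut : ∀ k → C (lastCut k)
  lastCut-cut zero = C0
  lastCut-cut (suc k) with C? (suc k)
  ... | yes c = c
  ... | no  _ = lastCut-cut k

  lastCut-last : ∀ {k p} → lastCut k < p → p ≤ k → ¬ C p
  lastCut-last {zero} l<p p≤0 = contradiction l<p (≤⇒≯ p≤0)
  lastCut-last {suc k} l<p p≤k with C? (suc k)
  ... | yes _ = contradiction l<p (≤⇒≯ p≤k)
  ... | no ¬c with m≤n⇒m<n∨m≡n p≤k
  ...   | inj₁ p<1+k = lastCut-last l<p (≤-pred p<1+k)
  ...   | inj₂ refl  = ¬c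

  firstCut : ℕ → ℕ → ℕ
  firstCut i zero = i
  firstCut i (suc d) with C? i
  ... | yes _ = i
  ... | no  _ = firstCut (suc i) d

  firstCut-≥ : ∀ i d → i ≤ firstCut i d
  firstCut-≥ i zero = ≤-refl
  firstCut-≥ i (suc d) with C? i
  ... | yes _ = ≤-refl
  ... | no  _ = ≤-trans (n≤1+n i) (firstCut-≥ (suc i) d)

  firstCut-≤ : ∀ i d → firstCut i d ≤ i + d
  firstCut-≤ i zero = ≤-reflexive (sym (+-identityʳ i))
  firstCut-≤ i (suc d) with C? i
  ... | yes _ = m≤m+n i (suc d)
  ... | no  _ = subst (firstCut (suc i) d ≤_) (sym (+-suc i d)) (firstCut-≤ (suc i) d)

  firstCut-cut : ∀ i d → firstCut i d < i + d → C (firstCut i d)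
  firstCut-cut i zero f<i+0 = contradiction (≤-reflexive (+-identityʳ i)) (<⇒≱ f<i+0)
  firstCut-cut i (suc d) f<i+d with C? i
  ... | yes c = c
  ... | no  _ = firstCut-cut (suc i) d (subst (firstCut (suc i) d <_) (+-suc i d) f<i+d)

  firstCut-first : ∀ i d {p} → i ≤ p → p < firstCut i d → ¬ C p
  firstCut-first i zero i≤p p<i = contradiction i≤p (<⇒≱ p<i)
  firstCut-first i (suc d) i≤p p<f with C? i
  ... | yes _ = contradiction i≤p (<⇒≱ p<f)
  ... | no ¬c with m≤n⇒m<n∨m≡n i≤p
  ...   | inj₁ i<p = firstCut-first (suc i) d i<p p<f
  ...   | inj₂ refl = ¬c

  nextCut : ℕ → ℕ
  nextCut k = firstCut (suc k) (n ∸ suc k)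

  nextCut-> : ∀ k → k < nextCut k
  nextCut-> k = firstCut-≥ (suc k) (n ∸ suc k)

  nextCut-≤ : ∀ {k} → k < n → nextCut k ≤ n
  nextCut-≤ {k} k<n = subst (nextCut k ≤_) (m+[n∸m]≡n k<n) (firstCut-≤ (suc k) (n ∸ suc k))

  nextCut-cut : ∀ {k} → k < n → nextCut k < n → C (nextCut k)
  nextCut-cut {k} k<n next<n =
    firstCut-cut (suc k) (n ∸ suc k) (subst (nextCut k <_) (sym (m+[n∸m]≡n k<n)) next<n)

  nextCut-first : ∀ {k p} → k < p → p < nextCut k → ¬ C p
  nextCut-first {k} = firstCut-first (suc k) (n ∸ suc k)

  record InGap (a e k : ℕ) : Set where
    field
      start<k   : a < k
      k<end     : k < e
      end≤n     : e ≤ n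
      start-cut : C a
      end-cut   : e < n → C e
      no-cut    : ∀ {p} → a < p → p < e → ¬ C p
  open InGap public

  inGap-of : ∀ {k} → k < n → ¬ C k → InGap (lastCut k) (nextCut k) k
  inGap-of {k} k<n ¬c = record
    { start<k   = ≤∧≢⇒< (lastCut-≤ k) (λ l≡k → ¬c (subst C l≡k (lastCut-cut k)))
    ; k<end     = nextCut-> k
    ; end≤n     = nextCut-≤ k<n
    ; start-cut = lastCut-cut k
    ; end-cut   = nextCut-cut k<n
    ; no-cut    = λ {p} l<p p<next → [ (λ p≤k → lastCut-last l<p p≤k)
                                      , (λ k<p → nextCut-first k<p p<next) ]′ (≤-<-connex p k)
    }

  inGap-unique : ∀ {a e a′ e′ k} → InGap a e k → InGap a′ e′ k → a ≡ a′ × e ≡ e′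
  inGap-unique G G′ = ≤-antisym (start-≤ G′ G) (start-≤ G G′) , ≤-antisym (end-≤ G G′) (end-≤ G′ G)
    where
      start-≤ : ∀ {a e a′ e′ k} → InGap a e k → InGap a′ e′ k → a′ ≤ a
      start-≤ G G′ = ≮⇒≥ (λ a<a′ → no-cut G a<a′ (<-trans (start<k G′) (k<end G)) (start-cut G′))
      end-≤ : ∀ {a e a′ e′ k} → InGap a e k → InGap a′ e′ k → e ≤ e′
      end-≤ G G′ = ≮⇒≥ (λ e′<e → no-cut G (<-trans (start<k G) (k<end G′)) e′<e
                                      (end-cut G′ (<-≤-trans e′<e (end≤n G))))

  inGap-end-≤-cut : ∀ {a e k j} → InGap a e k → k < j → C j → e ≤ j
  inGap-end-≤-cut G k<j cj = ≮⇒≥ (λ j<e → no-cut G (<-trans (start<k G) k<j) j<e cj)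

  inGap-move : ∀ {a e k k′} → InGap a e k → a < k′ → k′ < e → InGap a e k′
  inGap-move G a<k′ k′<e =
    record { start<k = a<k′ ; k<end = k′<e ; end≤n = end≤n G
           ; start-cut = start-cut G ; end-cut = end-cut G ; no-cut = no-cut G }

  inGap-mirror : ∀ {a e k} → InGap a e k → InGap a e (mirror a e k)
  inGap-mirror G = let (a<m , m<e) = mirror-inside (start<k G) (k<end G) in inGap-move G a<m m<e

  reflect : ℕ → ℕ
  reflect k with C? k
  ... | yes _ = k
  ... | no  _ = mirror (lastCut k) (nextCut k) k

  reflect-cut : ∀ {k} → C k → reflect k ≡ k
  reflect-cut {k} c with C? k
  ... | yes _  = refl
  ... | no  ¬c = contradiction c ¬c

  reflect-inGap : ∀ {a e k} → InGap a e k → reflect k ≡ mirror a e k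
  reflect-inGap {a} {e} {k} G with C? k
  ... | yes c  = contradiction c (no-cut G (start<k G) (k<end G))
  ... | no  ¬c with inGap-unique G (inGap-of (<-≤-trans (k<end G) (end≤n G)) ¬c)
  ...   | refl , refl = refl

  reflect-< : ∀ {k} → k < n → reflect k < n
  reflect-< {k} k<n with C? k
  ... | yes _  = k<n
  ... | no  ¬c = let G = inGap-of k<n ¬c in <-≤-trans (k<end (inGap-mirror G)) (end≤n G)

  reflect-involutive : ∀ {k} → k < n → reflect (reflect k) ≡ k
  reflect-involutive {k} k<n with C? k
  ... | yes c  = reflect-cut c
  ... | no  ¬c = let G = inGap-of k<n ¬c in
    trans (reflect-inGap (inGap-mirror G))
          (mirror-involutive {lastCut k} (≤-trans (<⇒≤ (k<end G)) (m≤n+m (nextCut k) (lastCut k))))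

  reflect-before-cut : ∀ {j m} → C j → m < j → j ≤ n → reflect m < j
  reflect-before-cut {j} {m} cj m<j j≤n with C? m
  ... | yes _  = m<j
  ... | no  ¬c = let G = inGap-of (<-≤-trans m<j j≤n) ¬c in
    <-≤-trans (k<end (inGap-mirror G)) (inGap-end-≤-cut G m<j cj)

module _ {C D : ℕ → Set} (C? : Decidable C) (D? : Decidable D) (C0 : C 0) (D0 : D 0) {n : ℕ}
         (C⇔D : ∀ {k} → k < n → C k ⇔ D k) where
  private
    module GC = GapReversal C? C0 n
    module GD = GapReversal D? D0 n
    open Equivalence

  inGap-transfer : ∀ {a e k} → GC.InGap a e k → GD.InGap a e k
  inGap-transfer G = record
    { start<k   = GC.start<k G
    ; k<end     = GC.k<end G
    ; end≤n     = GC.end≤n G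
    ; start-cut = to (C⇔D a<n) (GC.start-cut G)
    ; end-cut   = λ e<n → to (C⇔D e<n) (GC.end-cut G e<n)
    ; no-cut    = λ a<p p<e dp → GC.no-cut G a<p p<e (from (C⇔D (<-≤-trans p<e (GC.end≤n G))) dp)
    }
    where a<n = <-trans (GC.start<k G) (<-≤-trans (GC.k<end G) (GC.end≤n G))

  reflect-cong : ∀ {k} → k < n → GC.reflect k ≡ GD.reflect k
  reflect-cong {k} k<n = by-cases (C? k)
    where
      by-cases : Dec (C k) → GC.reflect k ≡ GD.reflect k
      by-cases (yes c)  = trans (GC.reflect-cut c) (sym (GD.reflect-cut (to (C⇔D k<n) c)))
      by-cases (no  ¬c) = let G = GC.inGap-of k<n ¬c in
        trans (GC.reflect-inGap G) (sym (GD.reflect-inGap (inGap-transfer G)))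

InjectiveBelow : (ℕ → ℕ) → ℕ → Set
InjectiveBelow f n = ∀ {i j} → i < n → j < n → f i ≡ f j → i ≡ j

LRMin : (ℕ → ℕ) → ℕ → Set
LRMin f j = ∀ {m} → m < j → f j < f m

LRMin? : ∀ f → Decidable (LRMin f)
LRMin? f j = allUpTo? (λ m → f j <? f m) j

LRMin-zero : ∀ f → LRMin f 0
LRMin-zero f ()

¬LRMin⇒smaller-before : ∀ {f j} → ¬ LRMin f j → ∃[ m ] m < j × f m ≤ f j
¬LRMin⇒smaller-before {f} {j} ¬min with anyUpTo? (λ m → f m ≤? f j) j
... | yes smaller = smaller
... | no  ∄smaller = contradiction (λ {m} m<j → ≰⇒> (λ fm≤fj → ∄smaller (m , m<j , fm≤fj))) ¬min

LRMin-minimum : ∀ {f a} k → LRMin f a → (∀ {p} → a < p → p ≤ k → ¬ LRMin f p) →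
                ∀ {p} → p ≤ k → f a ≤ f p
LRMin-minimum {f} {a} k min-a none {p} p≤k with <-cmp p a | m≤n⇒m<n∨m≡n p≤k
... | tri< p<a _ _ | _ = <⇒≤ (min-a p<a)
... | tri≈ _ refl _ | _ = ≤-refl
... | tri> _ _ a<p | inj₁ (s≤s p≤k′) =
  LRMin-minimum _ min-a (λ a<q q≤k′ → none a<q (m≤n⇒m≤1+n q≤k′)) p≤k′
... | tri> _ _ a<p | inj₂ refl with ¬LRMin⇒smaller-before (none a<p ≤-refl)
...   | m , s≤s m≤k′ , fm≤fp =
  ≤-trans (LRMin-minimum _ min-a (λ a<q q≤k′ → none a<q (m≤n⇒m≤1+n q≤k′)) m≤k′) fm≤fp

module LRGaps (f : ℕ → ℕ) (n : ℕ) = GapReversal (LRMin? f) (LRMin-zero f) n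

module _ {f : ℕ → ℕ} {n : ℕ} where
  open LRGaps f n

  inGap-start-≤ : ∀ {a e k} → InGap a e k → f a ≤ f k
  inGap-start-≤ G =
    LRMin-minimum _ (start-cut G) (λ a<p p≤k → no-cut G a<p (≤-<-trans p≤k (k<end G))) ≤-refl

  inGap-start-< : InjectiveBelow f n → ∀ {a e k} → InGap a e k → f a < f k
  inGap-start-< inj G = ≤∧≢⇒< (inGap-start-≤ G) (λ fa≡fk → <⇒≢ (start<k G) (inj a<n k<n fa≡fk))
    where
      k<n = <-≤-trans (k<end G) (end≤n G)
      a<n = <-trans (start<k G) k<n

  module _ {g : ℕ → ℕ} (g≗f∘reflect : ∀ {m} → m < n → g m ≡ f (reflect m)) where

    reversed-at-cut : ∀ {k} → k < n → LRMin f k → g k ≡ f k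
    reversed-at-cut k<n min-k = trans (g≗f∘reflect k<n) (cong f (reflect-cut min-k))

    reversed-at-reflect : ∀ {k} → k < n → g (reflect k) ≡ f k
    reversed-at-reflect k<n = trans (g≗f∘reflect (reflect-< k<n)) (cong f (reflect-involutive k<n))

    LRMin-reversed : ∀ {j} → j < n → LRMin g j ⇔ LRMin f j
    LRMin-reversed {j} j<n = mk⇔ reversed⇒original original⇒reversed
      where
        open ≤-Reasoning
        original⇒reversed : LRMin f j → LRMin g j
        original⇒reversed min-j {m} m<j = begin-strict
          g j              ≡⟨ reversed-at-cut j<n min-j ⟩
          f j              <⟨ min-j (reflect-before-cut min-j m<j (<⇒≤ j<n)) ⟩
          f (reflect m)    ≡⟨ g≗f∘reflect (<-trans m<j j<n) ⟨
          g m              ∎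
        reversed⇒original : LRMin g j → LRMin f j
        reversed⇒original min-j with LRMin? f j
        ... | yes min-f = min-f
        ... | no ¬min-f = contradiction (min-j (start<k G)) (≤⇒≯ ga≤gj)
          where
            G = inGap-of j<n ¬min-f
            ga≤gj : g (lastCut j) ≤ g j
            ga≤gj = begin
              g (lastCut j)                         ≡⟨ reversed-at-cut (<-trans (start<k G) j<n) (start-cut G) ⟩
              f (lastCut j)                         ≤⟨ inGap-start-≤ (inGap-mirror G) ⟩
              f (mirror (lastCut j) (nextCut j) j)  ≡⟨ cong f (reflect-inGap G) ⟨
              f (reflect j)                         ≡⟨ g≗f∘reflect j<n ⟨
              g j                                   ∎

    reflect-reversed : ∀ {k} → k < n → LRGaps.reflect g n k ≡ reflect k
    reflect-reversed = reflect-cong (LRMin? g) (LRMin? f) (LRMin-zero g) (LRMin-zero f) LRMin-reversed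

-- An occurrence of (123, R) or of (132, R), according as f b < f c or f c < f b.
record Occurrence (f : ℕ → ℕ) (a b c : ℕ) : Set where
  field
    a<b         : a < b
    b<c         : b < c
    start-below : ∀ {m} → a < m → m ≤ c → f a < f m
    left-above  : ∀ {m} → m < a → f b < f m × f c < f m
open Occurrence

module _ {f : ℕ → ℕ} {n : ℕ} where
  open LRGaps f n

  occurrence-start-LRMin : ∀ {a b c} → Occurrence f a b c → LRMin f a
  occurrence-start-LRMin O m<a = <-trans (start-below O (a<b O) (<⇒≤ (b<c O))) (proj₁ (left-above O m<a))

  occurrence-inGap : ∀ {a b c} → c < n → Occurrence f a b c → InGap a (nextCut c) c
  occurrence-inGap {a} {b} {c} c<n O = record
    { start<k   = a<c
    ; k<end     = nextCut-> c
    ; end≤n     = nextCut-≤ c<n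
    ; start-cut = occurrence-start-LRMin O
    ; end-cut   = nextCut-cut c<n
    ; no-cut    = λ {p} a<p p<e → [ (λ p≤c min-p → <-asym (start-below O a<p p≤c) (min-p a<p))
                                  , (λ c<p → nextCut-first c<p p<e) ]′ (≤-<-connex p c)
    }
    where a<c = <-trans (a<b O) (b<c O)

  occurrence-reversed : InjectiveBelow f n → ∀ {g} → (∀ {m} → m < n → g m ≡ f (reflect m)) →
                        ∀ {a b c} → c < n → Occurrence f a b c → Occurrence g a (reflect c) (reflect b)
  occurrence-reversed inj {g} g≗f∘reflect {a} {b} {c} c<n O = record
    { a<b = a<ρc ; b<c = ρc<ρb ; start-below = start-below′ ; left-above = left-above′ }
    where
      open ≤-Reasoning
      G  = occurrence-inGap c<n O
      e  = nextCut c
      Gb = inGap-move G (a<b O) (<-trans (b<c O) (k<end G))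
      e≤n = end≤n G
      ρc≡ = reflect-inGap G
      ρb≡ = reflect-inGap Gb
      a<ρc : a < reflect c
      a<ρc = subst (a <_) (sym ρc≡) (start<k (inGap-mirror G))
      ρc<ρb : reflect c < reflect b
      ρc<ρb = subst₂ _<_ (sym ρc≡) (sym ρb≡)
                (mirror-antitone {a} {e} (b<c O) (≤-trans (<⇒≤ (k<end G)) (m≤n+m e a)))
      ρb<e : reflect b < e
      ρb<e = subst (_< e) (sym ρb≡) (k<end (inGap-mirror Gb))
      start-below′ : ∀ {m} → a < m → m ≤ reflect b → g a < g m
      start-below′ {m} a<m m≤ρb = begin-strict
        g a               ≡⟨ reversed-at-cut g≗f∘reflect (<-trans (start<k G) c<n) (start-cut G) ⟩
        f a               <⟨ inGap-start-< inj (inGap-mirror Gm) ⟩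
        f (mirror a e m)  ≡⟨ cong f (reflect-inGap Gm) ⟨
        f (reflect m)     ≡⟨ g≗f∘reflect (<-≤-trans m<e e≤n) ⟨
        g m               ∎
        where
          m<e = ≤-<-trans m≤ρb ρb<e
          Gm  = inGap-move G a<m m<e
      left-above′ : ∀ {m} → m < a → g (reflect c) < g m × g (reflect b) < g m
      left-above′ {m} m<a = to-g (proj₂ (left-above O ρm<a)) c<n , to-g (proj₁ (left-above O ρm<a)) b<n
        where
          a≤n = ≤-trans (<⇒≤ (start<k G)) (<⇒≤ c<n)
          ρm<a = reflect-before-cut (start-cut G) m<a a≤n
          b<n = <-trans (b<c O) c<n
          to-g : ∀ {k} → f k < f (reflect m) → k < n → g (reflect k) < g m
          to-g fk<fρm k<n = subst₂ _<_ (sym (reversed-at-reflect g≗f∘reflect k<n))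
                                        (sym (g≗f∘reflect (<-≤-trans m<a a≤n))) fk<fρm

-- The boxes (i, j) of R are empty, for an occurrence with sorted values v₁ < v₂ < v₃.
record Shading (f : ℕ → ℕ) (a b c v₁ v₂ v₃ : ℕ) : Set where
  field
    box₀₀ : ∀ {m} → m < a → ¬ f m < v₁
    box₀₁ : ∀ {m} → m < a → v₁ < f m → ¬ f m < v₂
    box₀₂ : ∀ {m} → m < a → v₂ < f m → ¬ f m < v₃
    box₁₀ : ∀ {m} → a < m → m < b → ¬ f m < v₁
    box₂₀ : ∀ {m} → b < m → m < c → ¬ f m < v₁
open Shading

Occurrence123 Occurrence132 : (ℕ → ℕ) → ℕ → ℕ → ℕ → Set
Occurrence123 f a b c = Occurrence f a b c × f b < f c
Occurrence132 f a b c = Occurrence f a b c × f c < f b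

above-three : ∀ {x v₁ v₂ v₃} → ¬ x < v₁ → (v₁ < x → ¬ x < v₂) → (v₂ < x → ¬ x < v₃) →
              x ≢ v₁ → x ≢ v₂ → x ≢ v₃ → v₃ < x
above-three {x} x≮v₁ gap₁₂ gap₂₃ x≢v₁ x≢v₂ x≢v₃ = >-from (gap₂₃ v₂<x) x≢v₃
  where
    >-from : ∀ {v} → ¬ x < v → x ≢ v → v < x
    >-from x≮v x≢v = ≤∧≢⇒< (≮⇒≥ x≮v) (λ v≡x → x≢v (sym v≡x))
    v₂<x = >-from (gap₁₂ (>-from x≮v₁ x≢v₁)) x≢v₂

module _ {f : ℕ → ℕ} {n : ℕ} (inj : InjectiveBelow f n) {a b c : ℕ}
         (a<b : a < b) (b<c : b < c) (c<n : c < n) where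
  private
    b<n = <-trans b<c c<n
    a<c = <-trans a<b b<c
    a<n = <-trans a<c c<n
    ≢-at : ∀ {i j} → i < n → j < n → i ≢ j → f i ≢ f j
    ≢-at i<n j<n i≢j fi≡fj = i≢j (inj i<n j<n fi≡fj)

  shading-start-below : ∀ {v₂ v₃} → Shading f a b c (f a) v₂ v₃ → f a < f b → f a < f c →
                        ∀ {m} → a < m → m ≤ c → f a < f m
  shading-start-below S fa<fb fa<fc {m} a<m m≤c with <-cmp m b | m≤n⇒m<n∨m≡n m≤c
  ... | tri≈ _ refl _ | _        = fa<fb
  ... | _             | inj₂ refl = fa<fc
  ... | tri< m<b _ _  | inj₁ m<c =
    ≤∧≢⇒< (≮⇒≥ (box₁₀ S a<m m<b)) (≢-at a<n (<-trans m<c c<n) (<⇒≢ a<m))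
  ... | tri> _ _ b<m  | inj₁ m<c =
    ≤∧≢⇒< (≮⇒≥ (box₂₀ S b<m m<c)) (≢-at a<n (<-trans m<c c<n) (<⇒≢ a<m))

  shading-left-above : ∀ {p q} → a < p → p < n → a < q → q < n → Shading f a b c (f a) (f p) (f q) →
                       ∀ {m} → m < a → f q < f m
  shading-left-above a<p p<n a<q q<n S {m} m<a =
    above-three (box₀₀ S m<a) (box₀₁ S m<a) (box₀₂ S m<a)
                (≢-at m<n a<n (<⇒≢ m<a))
                (≢-at m<n p<n (<⇒≢ (<-trans m<a a<p)))
                (≢-at m<n q<n (<⇒≢ (<-trans m<a a<q)))
    where m<n = <-trans m<a a<n

  shading⇒occurrence123 : f a < f b → f b < f c → Shading f a b c (f a) (f b) (f c) → Occurrence123 f a b c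
  shading⇒occurrence123 fa<fb fb<fc S =
    record { a<b = a<b ; b<c = b<c
           ; start-below = shading-start-below S fa<fb (<-trans fa<fb fb<fc)
           ; left-above  = λ m<a → let fc<fm = shading-left-above a<b b<n a<c c<n S m<a
                                   in <-trans fb<fc fc<fm , fc<fm } ,
    fb<fc

  shading⇒occurrence132 : f a < f c → f c < f b → Shading f a b c (f a) (f c) (f b) → Occurrence132 f a b c
  shading⇒occurrence132 fa<fc fc<fb S =
    record { a<b = a<b ; b<c = b<c
           ; start-below = shading-start-below S (<-trans fa<fc fc<fb) fa<fc
           ; left-above  = λ m<a → let fb<fm = shading-left-above a<c c<n a<b b<n S m<a
                                   in fb<fm , <-trans fc<fb fb<fm } ,
    fc<fb

occurrence⇒shading : ∀ {f a b c v₂ v₃} → Occurrence f a b c →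
                     (∀ {m} → m < a → v₂ < f m × v₃ < f m) → Shading f a b c (f a) v₂ v₃
occurrence⇒shading O above = record
  { box₀₀ = λ m<a fm<fa →
      <-asym fm<fa (<-trans (start-below O (a<b O) (<⇒≤ (b<c O))) (proj₁ (left-above O m<a)))
  ; box₀₁ = λ m<a _ fm<v₂ → <-asym fm<v₂ (proj₁ (above m<a))
  ; box₀₂ = λ m<a _ fm<v₃ → <-asym fm<v₃ (proj₂ (above m<a))
  ; box₁₀ = λ a<m m<b fm<fa → <-asym fm<fa (start-below O a<m (<⇒≤ (<-trans m<b (b<c O))))
  ; box₂₀ = λ b<m m<c fm<fa → <-asym fm<fa (start-below O (<-trans (a<b O) b<m) (<⇒≤ m<c))
  }

-- 0 past the end of the vector.
entry : ∀ {n k} → Vec (Fin n) k → ℕ → ℕ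
entry []       m       = 0
entry (x ∷ xs) zero    = toℕ x
entry (x ∷ xs) (suc m) = entry xs m

entry-lookup : ∀ {n k} (v : Vec (Fin n) k) i → entry v (toℕ i) ≡ toℕ (lookup v i)
entry-lookup (x ∷ xs) Fin.zero    = refl
entry-lookup (x ∷ xs) (Fin.suc i) = entry-lookup xs i

entry-fromℕ< : ∀ {n k} (v : Vec (Fin n) k) {m} (m<k : m < k) → toℕ (lookup v (fromℕ< m<k)) ≡ entry v m
entry-fromℕ< v {m} m<k = trans (sym (entry-lookup v (fromℕ< m<k))) (cong (entry v) (toℕ-fromℕ< m<k))

≢ᵇ-true⇒≢ : ∀ {m n} → not (m ≡ᵇ n) ≡ true → m ≢ n
≢ᵇ-true⇒≢ {m} h refl with m ≡ᵇ m | ≡⇒≡ᵇ m m refl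
... | true | _ = contradiction h λ ()

≢⇒≢ᵇ-true : ∀ {m n} → m ≢ n → not (m ≡ᵇ n) ≡ true
≢⇒≢ᵇ-true {m} {n} m≢n with m ≡ᵇ n in eq
... | false = refl
... | true  = contradiction (≡ᵇ⇒≡ m n (Equivalence.from T-≡ eq)) m≢n

Fresh : ∀ {n k} → Fin n → Vec (Fin n) k → Bool
Fresh x xs = allB (λ y → not (toℕ x ≡ᵇ toℕ y)) (toList xs)

fresh⇒≢ : ∀ {n k} {x : Fin n} (xs : Vec (Fin n) k) → Fresh x xs ≡ true →
          ∀ {m} → m < k → toℕ x ≢ entry xs m
fresh⇒≢ (y ∷ ys) h {zero}  _         = ≢ᵇ-true⇒≢ (∧-conicalˡ _ _ h)
fresh⇒≢ (y ∷ ys) h {suc m} (s≤s m<k) = fresh⇒≢ ys (∧-conicalʳ _ _ h) m<k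

≢⇒fresh : ∀ {n k} {x : Fin n} (xs : Vec (Fin n) k) → (∀ {m} → m < k → toℕ x ≢ entry xs m) →
          Fresh x xs ≡ true
≢⇒fresh []       _  = refl
≢⇒fresh (y ∷ ys) x≢ rewrite ≢⇒≢ᵇ-true (x≢ {zero} z<s) = ≢⇒fresh ys (λ m<k → x≢ (s≤s m<k))

distinct⇒injective : ∀ {n k} (v : Vec (Fin n) k) → distinct v ≡ true → InjectiveBelow (entry v) k
distinct⇒injective (x ∷ xs) h {zero}  {zero}  _         _         _  = refl
distinct⇒injective (x ∷ xs) h {zero}  {suc j} _         (s≤s j<k) eq =
  contradiction eq (fresh⇒≢ xs (∧-conicalˡ _ _ h) j<k)
distinct⇒injective (x ∷ xs) h {suc i} {zero}  (s≤s i<k) _         eq =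
  contradiction (sym eq) (fresh⇒≢ xs (∧-conicalˡ _ _ h) i<k)
distinct⇒injective (x ∷ xs) h {suc i} {suc j} (s≤s i<k) (s≤s j<k) eq =
  cong suc (distinct⇒injective xs (∧-conicalʳ (Fresh x xs) _ h) i<k j<k eq)

injective⇒distinct : ∀ {n k} (v : Vec (Fin n) k) → InjectiveBelow (entry v) k → distinct v ≡ true
injective⇒distinct []       _   = refl
injective⇒distinct (x ∷ xs) inj
  rewrite ≢⇒fresh xs (λ m<k x≡ → 0≢1+n (inj z<s (s≤s m<k) x≡)) =
  injective⇒distinct xs (λ i<k j<k eq → suc-injective (inj (s≤s i<k) (s≤s j<k) eq))

reflectFin : ∀ {n} → Vec (Fin n) n → Fin n → Fin n
reflectFin {n} σ i = fromℕ< (LRGaps.reflect-< (entry σ) n (toℕ<n i))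

reverseGaps : ∀ {n} → Vec (Fin n) n → Vec (Fin n) n
reverseGaps σ = tabulate (λ i → lookup σ (reflectFin σ i))

module _ {n : ℕ} (σ : Vec (Fin n) n) where
  open LRGaps (entry σ) n
  open ≡-Reasoning

  toℕ-reflectFin : ∀ i → toℕ (reflectFin σ i) ≡ reflect (toℕ i)
  toℕ-reflectFin i = toℕ-fromℕ< (reflect-< (toℕ<n i))

  reflectFin-involutive : ∀ i → reflectFin σ (reflectFin σ i) ≡ i
  reflectFin-involutive i = toℕ-injective (begin
    toℕ (reflectFin σ (reflectFin σ i))  ≡⟨ toℕ-reflectFin (reflectFin σ i) ⟩
    reflect (toℕ (reflectFin σ i))       ≡⟨ cong reflect (toℕ-reflectFin i) ⟩
    reflect (reflect (toℕ i))            ≡⟨ reflect-involutive (toℕ<n i) ⟩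
    toℕ i                                ∎)

  entry-reverseGaps : ∀ {m} → m < n → entry (reverseGaps σ) m ≡ entry σ (reflect m)
  entry-reverseGaps {m} m<n = begin
    entry (reverseGaps σ) m                ≡⟨ entry-fromℕ< (reverseGaps σ) m<n ⟨
    toℕ (lookup (reverseGaps σ) i)         ≡⟨ cong toℕ (lookup∘tabulate _ i) ⟩
    toℕ (lookup σ (reflectFin σ i))        ≡⟨ entry-lookup σ (reflectFin σ i) ⟨
    entry σ (toℕ (reflectFin σ i))         ≡⟨ cong (entry σ) (toℕ-reflectFin i) ⟩
    entry σ (reflect (toℕ i))              ≡⟨ cong (λ k → entry σ (reflect k)) (toℕ-fromℕ< m<n) ⟩
    entry σ (reflect m)                    ∎
    where i = fromℕ< m<n

  reflectFin-reverseGaps : ∀ i → reflectFin (reverseGaps σ) i ≡ reflectFin σ i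
  reflectFin-reverseGaps i = toℕ-injective (begin
    toℕ (reflectFin (reverseGaps σ) i)                  ≡⟨ toℕ-fromℕ< _ ⟩
    LRGaps.reflect (entry (reverseGaps σ)) n (toℕ i)    ≡⟨ reflect-reversed entry-reverseGaps (toℕ<n i) ⟩
    reflect (toℕ i)                                     ≡⟨ toℕ-reflectFin i ⟨
    toℕ (reflectFin σ i)                                ∎)

  reverseGaps-involutive : reverseGaps (reverseGaps σ) ≡ σ
  reverseGaps-involutive = trans (tabulate-cong lookup-twice) (tabulate∘lookup σ)
    where
      lookup-twice : ∀ i → lookup (reverseGaps σ) (reflectFin (reverseGaps σ) i) ≡ lookup σ i
      lookup-twice i = begin
        lookup (reverseGaps σ) (reflectFin (reverseGaps σ) i)
          ≡⟨ cong (lookup (reverseGaps σ)) (reflectFin-reverseGaps i) ⟩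
        lookup (reverseGaps σ) (reflectFin σ i)                ≡⟨ lookup∘tabulate _ (reflectFin σ i) ⟩
        lookup σ (reflectFin σ (reflectFin σ i))               ≡⟨ cong (lookup σ) (reflectFin-involutive i) ⟩
        lookup σ i                                             ∎

  reverseGaps-perm : IsPerm σ ≡ true → IsPerm (reverseGaps σ) ≡ true
  reverseGaps-perm perm = injective⇒distinct (reverseGaps σ) λ {i} {j} i<n j<n eq → begin
    i                      ≡⟨ reflect-involutive i<n ⟨
    reflect (reflect i)    ≡⟨ cong reflect (distinct⇒injective σ perm (reflect-< i<n) (reflect-< j<n) (begin
      entry σ (reflect i)      ≡⟨ entry-reverseGaps i<n ⟨
      entry (reverseGaps σ) i  ≡⟨ eq ⟩
      entry (reverseGaps σ) j  ≡⟨ entry-reverseGaps j<n ⟩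
      entry σ (reflect j)      ∎)) ⟩
    reflect (reflect j)    ≡⟨ reflect-involutive j<n ⟩
    j                      ∎

IsPerm-reverseGaps : ∀ {n} (σ : Vec (Fin n) n) → IsPerm (reverseGaps σ) ≡ IsPerm σ
IsPerm-reverseGaps σ = ⇔→≡ (mk⇔ from-reversed (reverseGaps-perm σ))
  where
    from-reversed : IsPerm (reverseGaps σ) ≡ true → IsPerm σ ≡ true
    from-reversed perm = subst (λ τ → IsPerm τ ≡ true) (reverseGaps-involutive σ)
                               (reverseGaps-perm (reverseGaps σ) perm)

p123 p132 : MeshPattern
p123 = mesh 3 τ123 R₃₁
p132 = mesh 3 τ132 R₃₁

<⇒<ᵇ≡true : ∀ {m n} → m < n → (m <ᵇ n) ≡ true
<⇒<ᵇ≡true m<n = Equivalence.to T-≡ (<⇒<ᵇ m<n)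

<ᵇ≡true⇒< : ∀ {m n} → (m <ᵇ n) ≡ true → m < n
<ᵇ≡true⇒< {m} {n} eq = <ᵇ⇒< m n (Equivalence.from T-≡ eq)

≤⇒≮ᵇ : ∀ {m n} → n ≤ m → (m <ᵇ n) ≡ false
≤⇒≮ᵇ {m} {n} n≤m with m <ᵇ n in eq
... | false = refl
... | true  = contradiction (<ᵇ≡true⇒< eq) (≤⇒≯ n≤m)

∧-true : ∀ {a b} → a ≡ true → b ≡ true → a ∧ b ≡ true
∧-true refl refl = refl

∧₄-false : ∀ {a b c d} → (a ≡ true → b ≡ true → c ≡ true → d ≡ true → ⊥) →
           a ∧ b ∧ c ∧ d ≡ false
∧₄-false {true}  {true}  {true}  {true}  ¬all = ⊥-elim (¬all refl refl refl refl)
∧₄-false {true}  {true}  {true}  {false} _ = refl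
∧₄-false {true}  {true}  {false}         _ = refl
∧₄-false {true}  {false}                 _ = refl
∧₄-false {false}                         _ = refl

allB-true⇒All : (bs : List Bool) → allB id bs ≡ true → All (_≡ true) bs
allB-true⇒All []       _ = []
allB-true⇒All (b ∷ bs) h = ∧-conicalˡ b _ h ∷ allB-true⇒All bs (∧-conicalʳ b _ h)

All⇒allB-true : (bs : List Bool) → All (_≡ true) bs → allB id bs ≡ true
All⇒allB-true []       []         = refl
All⇒allB-true (b ∷ bs) (b≡ ∷ bs≡) = ∧-true b≡ (All⇒allB-true bs bs≡)

anyB-false⇒ : ∀ {A : Set} (p : A → Bool) xs → anyB p xs ≡ false → ∀ {x} → x ∈ xs → p x ≡ false
anyB-false⇒ p (y ∷ ys) h x∈ with p y in py
anyB-false⇒ p (y ∷ ys) () x∈          | true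
anyB-false⇒ p (y ∷ ys) h  (here refl) | false = py
anyB-false⇒ p (y ∷ ys) h  (there x∈)  | false = anyB-false⇒ p ys h x∈

⇒anyB-false : ∀ {A : Set} (p : A → Bool) xs → (∀ {x} → x ∈ xs → p x ≡ false) → anyB p xs ≡ false
⇒anyB-false p []       _     = refl
⇒anyB-false p (y ∷ ys) none rewrite none (here refl) = ⇒anyB-false p ys (λ x∈ → none (there x∈))

module _ {n : ℕ} (σ : Vec (Fin n) n) where

  value : Fin n → ℕ
  value i = toℕ (lookup σ i)

  -- As in IsOccurrence, bounds are 1-based and 0 means unbounded below.
  emptyBox : (i₀ i₁ v₀ v₁ : ℕ) → Bool
  emptyBox i₀ i₁ v₀ v₁ = not (anyB (λ m → (i₀ <ᵇ suc (toℕ m)) ∧ (suc (toℕ m) <ᵇ i₁)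
                                         ∧ (v₀ <ᵇ suc (value m)) ∧ (suc (value m) <ᵇ v₁)) (allFin n))

  shadingBoxes : (a b c v₁ v₂ v₃ : ℕ) → List Bool
  shadingBoxes a b c v₁ v₂ v₃ =
    emptyBox 0 a 0 v₁ ∷ emptyBox 0 a v₁ v₂ ∷ emptyBox 0 a v₂ v₃ ∷
    emptyBox a b 0 v₁ ∷ emptyBox b c 0 v₁ ∷ []

  shadingEmpty : (a b c v₁ v₂ v₃ : ℕ) → Bool
  shadingEmpty a b c v₁ v₂ v₃ = allB id (shadingBoxes a b c v₁ v₂ v₃)

  BoxEmpty : (i₀ i₁ v₀ v₁ : ℕ) → Set
  BoxEmpty i₀ i₁ v₀ v₁ =
    ∀ {m} → m < n → i₀ < suc m → suc m < i₁ → v₀ < suc (entry σ m) → suc (entry σ m) < v₁ → ⊥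

  emptyBox-sound : ∀ {i₀ i₁ v₀ v₁} → emptyBox i₀ i₁ v₀ v₁ ≡ true → BoxEmpty i₀ i₁ v₀ v₁
  emptyBox-sound {i₀} {i₁} {v₀} {v₁} h {m} m<n i₀<m m<i₁ v₀<fm fm<v₁ =
    contradiction (trans (sym in-box) (anyB-false⇒ _ (allFin n) (not-injective h) (∈-allFin i))) λ ()
    where
      i = fromℕ< m<n
      in-box : (i₀ <ᵇ suc (toℕ i)) ∧ (suc (toℕ i) <ᵇ i₁) ∧
               (v₀ <ᵇ suc (value i)) ∧ (suc (value i) <ᵇ v₁) ≡ true
      in-box rewrite toℕ-fromℕ< m<n | entry-fromℕ< σ m<n =
        ∧-true (<⇒<ᵇ≡true i₀<m) (∧-true (<⇒<ᵇ≡true m<i₁)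
          (∧-true (<⇒<ᵇ≡true v₀<fm) (<⇒<ᵇ≡true fm<v₁)))

  emptyBox-complete : ∀ i₀ i₁ v₀ v₁ → BoxEmpty i₀ i₁ v₀ v₁ → emptyBox i₀ i₁ v₀ v₁ ≡ true
  emptyBox-complete i₀ i₁ v₀ v₁ B =
    cong not (⇒anyB-false _ (allFin n) λ {i} _ → ∧₄-false λ i₀<m m<i₁ v₀<fm fm<v₁ →
    B (toℕ<n i) (<ᵇ≡true⇒< i₀<m) (<ᵇ≡true⇒< m<i₁)
      (subst (λ v → _ < suc v) (sym (entry-lookup σ i)) (<ᵇ≡true⇒< v₀<fm))
      (subst (λ v → suc v < _) (sym (entry-lookup σ i)) (<ᵇ≡true⇒< fm<v₁)))

  shadingEmpty⇔Shading : ∀ {a b c v₁ v₂ v₃} → a < b → b < c → c < n →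
    shadingEmpty (suc a) (suc b) (suc c) (suc v₁) (suc v₂) (suc v₃) ≡ true ⇔
    Shading (entry σ) a b c v₁ v₂ v₃
  shadingEmpty⇔Shading {a} {b} {c} {v₁} {v₂} {v₃} a<b b<c c<n = mk⇔ sound complete
    where
      b<n = <-trans b<c c<n
      a<n = <-trans a<b b<n
      boxes = shadingBoxes (suc a) (suc b) (suc c) (suc v₁) (suc v₂) (suc v₃)
      Shaded = Shading (entry σ) a b c v₁ v₂ v₃
      sound : allB id boxes ≡ true → Shaded
      sound h = from-boxes (allB-true⇒All boxes h)
        where
          from-boxes : All (_≡ true) boxes → Shaded
          from-boxes (B₀₀ ∷ B₀₁ ∷ B₀₂ ∷ B₁₀ ∷ B₂₀ ∷ []) = record
            { box₀₀ = λ m<a fm<v₁ →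
                emptyBox-sound B₀₀ (<-trans m<a a<n) z<s (s<s m<a) z<s (s<s fm<v₁)
            ; box₀₁ = λ m<a v₁<fm fm<v₂ →
                emptyBox-sound B₀₁ (<-trans m<a a<n) z<s (s<s m<a) (s<s v₁<fm) (s<s fm<v₂)
            ; box₀₂ = λ m<a v₂<fm fm<v₃ →
                emptyBox-sound B₀₂ (<-trans m<a a<n) z<s (s<s m<a) (s<s v₂<fm) (s<s fm<v₃)
            ; box₁₀ = λ a<m m<b fm<v₁ →
                emptyBox-sound B₁₀ (<-trans m<b b<n) (s<s a<m) (s<s m<b) z<s (s<s fm<v₁)
            ; box₂₀ = λ b<m m<c fm<v₁ →
                emptyBox-sound B₂₀ (<-trans m<c c<n) (s<s b<m) (s<s m<c) z<s (s<s fm<v₁)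
            }
      complete : Shaded → allB id boxes ≡ true
      complete S = All⇒allB-true boxes
        ( emptyBox-complete 0 (suc a) 0 (suc v₁) (λ _ _ m<a _ fm<v₁ →
            box₀₀ S (s<s⁻¹ m<a) (s<s⁻¹ fm<v₁))
        ∷ emptyBox-complete 0 (suc a) (suc v₁) (suc v₂) (λ _ _ m<a v₁<fm fm<v₂ →
            box₀₁ S (s<s⁻¹ m<a) (s<s⁻¹ v₁<fm) (s<s⁻¹ fm<v₂))
        ∷ emptyBox-complete 0 (suc a) (suc v₂) (suc v₃) (λ _ _ m<a v₂<fm fm<v₃ →
            box₀₂ S (s<s⁻¹ m<a) (s<s⁻¹ v₂<fm) (s<s⁻¹ fm<v₃))
        ∷ emptyBox-complete (suc a) (suc b) 0 (suc v₁) (λ _ a<m m<b _ fm<v₁ →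
            box₁₀ S (s<s⁻¹ a<m) (s<s⁻¹ m<b) (s<s⁻¹ fm<v₁))
        ∷ emptyBox-complete (suc b) (suc c) 0 (suc v₁) (λ _ b<m m<c _ fm<v₁ →
            box₂₀ S (s<s⁻¹ b<m) (s<s⁻¹ m<c) (s<s⁻¹ fm<v₁))
        ∷ [])

module _ {n : ℕ} (σ : Vec (Fin n) n) (x y z : Fin n) where
  private
    f = entry σ
    a = toℕ x
    b = toℕ y
    c = toℕ z
    v = value σ

    shadingEmptyAt : ℕ → ℕ → Bool
    shadingEmptyAt v₂ v₃ = shadingEmpty σ (suc a) (suc b) (suc c) (suc (v x)) (suc v₂) (suc v₃)

    shadingEmptyAt⇔ : ∀ {p q} → a < b → b < c →
      shadingEmptyAt (v p) (v q) ≡ true ⇔ Shading f a b c (f a) (f (toℕ p)) (f (toℕ q))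
    shadingEmptyAt⇔ {p} {q} a<b b<c
      rewrite entry-lookup σ x | entry-lookup σ p | entry-lookup σ q = shadingEmpty⇔Shading σ a<b b<c (toℕ<n z)

    value<⇒entry< : ∀ {i j} → v i < v j → f (toℕ i) < f (toℕ j)
    value<⇒entry< {i} {j} = subst₂ _<_ (sym (entry-lookup σ i)) (sym (entry-lookup σ j))

    entry<⇒value< : ∀ {i j} → f (toℕ i) < f (toℕ j) → v i < v j
    entry<⇒value< {i} {j} = subst₂ _<_ (entry-lookup σ i) (entry-lookup σ j)

  -- The value comparisons are rewritten in the order in which sort's insertion meets them.
  isOccurrence123≡shading : a < b → b < c → v x < v y → v y < v z →
    IsOccurrence p123 σ (x ∷ y ∷ z ∷ []) ≡ shadingEmptyAt (v y) (v z)
  isOccurrence123≡shading a<b b<c vx<vy vy<vz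
    rewrite <⇒<ᵇ≡true a<b | <⇒<ᵇ≡true (<-trans a<b b<c) | <⇒<ᵇ≡true b<c
          | ≤⇒≮ᵇ (≤-refl {v x}) | ≤⇒≮ᵇ (≤-refl {v y}) | ≤⇒≮ᵇ (≤-refl {v z})
          | <⇒<ᵇ≡true vy<vz | <⇒<ᵇ≡true vx<vy | <⇒<ᵇ≡true (<-trans vx<vy vy<vz)
          | ≤⇒≮ᵇ (<⇒≤ vx<vy) | ≤⇒≮ᵇ (<⇒≤ vy<vz) | ≤⇒≮ᵇ (<⇒≤ (<-trans vx<vy vy<vz)) = refl

  isOccurrence132≡shading : a < b → b < c → v x < v z → v z < v y →
    IsOccurrence p132 σ (x ∷ y ∷ z ∷ []) ≡ shadingEmptyAt (v z) (v y)
  isOccurrence132≡shading a<b b<c vx<vz vz<vy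
    rewrite <⇒<ᵇ≡true a<b | <⇒<ᵇ≡true (<-trans a<b b<c) | <⇒<ᵇ≡true b<c
          | ≤⇒≮ᵇ (≤-refl {v x}) | ≤⇒≮ᵇ (≤-refl {v y}) | ≤⇒≮ᵇ (≤-refl {v z})
          | ≤⇒≮ᵇ (<⇒≤ vz<vy) | <⇒<ᵇ≡true vx<vz | <⇒<ᵇ≡true (<-trans vx<vz vz<vy)
          | ≤⇒≮ᵇ (<⇒≤ vx<vz) | <⇒<ᵇ≡true vz<vy | ≤⇒≮ᵇ (<⇒≤ (<-trans vx<vz vz<vy)) = refl

  -- Evaluation of IsOccurrence: every row but the first makes one of its conjuncts false.
  isOccurrence123-order : IsOccurrence p123 σ (x ∷ y ∷ z ∷ []) ≡ true →
                          a < b × b < c × v x < v y × v y < v z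
  isOccurrence123-order h
    rewrite ≤⇒≮ᵇ (≤-refl {v x}) | ≤⇒≮ᵇ (≤-refl {v y}) | ≤⇒≮ᵇ (≤-refl {v z})
    with a <ᵇ b in a<b | a <ᵇ c | b <ᵇ c in b<c
       | v x <ᵇ v y in vx<vy | v x <ᵇ v z | v y <ᵇ v x
       | v y <ᵇ v z in vy<vz | v z <ᵇ v x | v z <ᵇ v y
  ... | true  | true  | true  | true  | true  | false | true  | false | false =
    <ᵇ≡true⇒< a<b , <ᵇ≡true⇒< b<c , <ᵇ≡true⇒< vx<vy , <ᵇ≡true⇒< vy<vz
  ... | false | _     | _     | _     | _     | _     | _     | _     | _     = case h of λ ()
  ... | true  | false | _     | _     | _     | _     | _     | _     | _     = case h of λ ()
  ... | true  | true  | false | _     | _     | _     | _     | _     | _     = case h of λ ()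
  ... | true  | true  | true  | false | _     | _     | _     | _     | _     = case h of λ ()
  ... | true  | true  | true  | true  | false | _     | _     | _     | _     = case h of λ ()
  ... | true  | true  | true  | true  | true  | true  | _     | _     | _     = case h of λ ()
  ... | true  | true  | true  | true  | true  | false | false | _     | _     = case h of λ ()
  ... | true  | true  | true  | true  | true  | false | true  | true  | _     = case h of λ ()
  ... | true  | true  | true  | true  | true  | false | true  | false | true  = case h of λ ()

  isOccurrence132-order : IsOccurrence p132 σ (x ∷ y ∷ z ∷ []) ≡ true →
                          a < b × b < c × v x < v z × v z < v y
  isOccurrence132-order h
    rewrite ≤⇒≮ᵇ (≤-refl {v x}) | ≤⇒≮ᵇ (≤-refl {v y}) | ≤⇒≮ᵇ (≤-refl {v z})
    with a <ᵇ b in a<b | a <ᵇ c | b <ᵇ c in b<c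
       | v x <ᵇ v y | v x <ᵇ v z in vx<vz | v y <ᵇ v x
       | v y <ᵇ v z | v z <ᵇ v x | v z <ᵇ v y in vz<vy
  ... | true  | true  | true  | true  | true  | false | false | false | true  =
    <ᵇ≡true⇒< a<b , <ᵇ≡true⇒< b<c , <ᵇ≡true⇒< vx<vz , <ᵇ≡true⇒< vz<vy
  ... | false | _     | _     | _     | _     | _     | _     | _     | _     = case h of λ ()
  ... | true  | false | _     | _     | _     | _     | _     | _     | _     = case h of λ ()
  ... | true  | true  | false | _     | _     | _     | _     | _     | _     = case h of λ ()
  ... | true  | true  | true  | false | _     | _     | _     | _     | _     = case h of λ ()
  ... | true  | true  | true  | true  | false | _     | _     | _     | _     = case h of λ ()
  ... | true  | true  | true  | true  | true  | true  | _     | _     | _     = case h of λ ()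
  ... | true  | true  | true  | true  | true  | false | true  | _     | _     = case h of λ ()
  ... | true  | true  | true  | true  | true  | false | false | true  | _     = case h of λ ()
  ... | true  | true  | true  | true  | true  | false | false | false | false = case h of λ ()

  occurrence123⇔ : IsPerm σ ≡ true → IsOccurrence p123 σ (x ∷ y ∷ z ∷ []) ≡ true ⇔ Occurrence123 f a b c
  occurrence123⇔ perm = mk⇔ sound complete
    where
      open Equivalence
      sound : IsOccurrence p123 σ (x ∷ y ∷ z ∷ []) ≡ true → Occurrence123 f a b c
      sound h with isOccurrence123-order h
      ... | a<b , b<c , vx<vy , vy<vz =
        shading⇒occurrence123 (distinct⇒injective σ perm) a<b b<c (toℕ<n z)
          (value<⇒entry< vx<vy) (value<⇒entry< vy<vz)
          (to (shadingEmptyAt⇔ a<b b<c) (trans (sym (isOccurrence123≡shading a<b b<c vx<vy vy<vz)) h))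
      complete : Occurrence123 f a b c → IsOccurrence p123 σ (x ∷ y ∷ z ∷ []) ≡ true
      complete (O , fb<fc) =
        trans (isOccurrence123≡shading (a<b O) (b<c O)
                 (entry<⇒value< (start-below O (a<b O) (<⇒≤ (b<c O)))) (entry<⇒value< fb<fc))
              (from (shadingEmptyAt⇔ (a<b O) (b<c O)) (occurrence⇒shading O (left-above O)))

  occurrence132⇔ : IsPerm σ ≡ true → IsOccurrence p132 σ (x ∷ y ∷ z ∷ []) ≡ true ⇔ Occurrence132 f a b c
  occurrence132⇔ perm = mk⇔ sound complete
    where
      open Equivalence
      sound : IsOccurrence p132 σ (x ∷ y ∷ z ∷ []) ≡ true → Occurrence132 f a b c
      sound h with isOccurrence132-order h
      ... | a<b , b<c , vx<vz , vz<vy =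
        shading⇒occurrence132 (distinct⇒injective σ perm) a<b b<c (toℕ<n z)
          (value<⇒entry< vx<vz) (value<⇒entry< vz<vy)
          (to (shadingEmptyAt⇔ a<b b<c) (trans (sym (isOccurrence132≡shading a<b b<c vx<vz vz<vy)) h))
      complete : Occurrence132 f a b c → IsOccurrence p132 σ (x ∷ y ∷ z ∷ []) ≡ true
      complete (O , fc<fb) =
        trans (isOccurrence132≡shading (a<b O) (b<c O)
                 (entry<⇒value< (start-below O (<-trans (a<b O) (b<c O)) ≤-refl)) (entry<⇒value< fc<fb))
              (from (shadingEmptyAt⇔ (a<b O) (b<c O)) (occurrence⇒shading O (swap ∘ left-above O)))

reverseTriple : ∀ {n} → Vec (Fin n) n → Vec (Fin n) 3 → Vec (Fin n) 3
reverseTriple σ (x ∷ y ∷ z ∷ []) = x ∷ reflectFin σ z ∷ reflectFin σ y ∷ []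

reverseTriple-involutive : ∀ {n} (σ : Vec (Fin n) n) → Involutive _≡_ (reverseTriple σ)
reverseTriple-involutive σ (x ∷ y ∷ z ∷ []) =
  cong₂ (λ y′ z′ → x ∷ y′ ∷ z′ ∷ []) (reflectFin-involutive σ y) (reflectFin-involutive σ z)

reverseTriple-reverseGaps : ∀ {n} (σ : Vec (Fin n) n) t → reverseTriple (reverseGaps σ) t ≡ reverseTriple σ t
reverseTriple-reverseGaps σ (x ∷ y ∷ z ∷ []) =
  cong₂ (λ y′ z′ → x ∷ y′ ∷ z′ ∷ []) (reflectFin-reverseGaps σ z) (reflectFin-reverseGaps σ y)

module _ {n : ℕ} (σ : Vec (Fin n) n) (perm : IsPerm σ ≡ true) where
  open LRGaps (entry σ) n

  entry-reverseGaps-reflectFin : ∀ i → entry (reverseGaps σ) (toℕ (reflectFin σ i)) ≡ entry σ (toℕ i)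
  entry-reverseGaps-reflectFin i = begin
    entry (reverseGaps σ) (toℕ (reflectFin σ i))  ≡⟨ cong (entry (reverseGaps σ)) (toℕ-reflectFin σ i) ⟩
    entry (reverseGaps σ) (reflect (toℕ i))       ≡⟨ entry-reverseGaps σ (reflect-< (toℕ<n i)) ⟩
    entry σ (reflect (reflect (toℕ i)))           ≡⟨ cong (entry σ) (reflect-involutive (toℕ<n i)) ⟩
    entry σ (toℕ i)                               ∎
    where open ≡-Reasoning

  occurrence-reverseGaps : ∀ {x y z : Fin n} → Occurrence (entry σ) (toℕ x) (toℕ y) (toℕ z) →
    Occurrence (entry (reverseGaps σ)) (toℕ x) (toℕ (reflectFin σ z)) (toℕ (reflectFin σ y))
  occurrence-reverseGaps {x} {y} {z} O =
    subst₂ (Occurrence (entry (reverseGaps σ)) (toℕ x)) (sym (toℕ-reflectFin σ z)) (sym (toℕ-reflectFin σ y))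
      (occurrence-reversed (distinct⇒injective σ perm) (entry-reverseGaps σ) (toℕ<n z) O)

  occurrence123⇒132 : ∀ t → IsOccurrence p123 σ t ≡ true →
                      IsOccurrence p132 (reverseGaps σ) (reverseTriple σ t) ≡ true
  occurrence123⇒132 (x ∷ y ∷ z ∷ []) h with Equivalence.to (occurrence123⇔ σ x y z perm) h
  ... | O , fb<fc =
    Equivalence.from (occurrence132⇔ (reverseGaps σ) x (reflectFin σ z) (reflectFin σ y) (reverseGaps-perm σ perm))
    (occurrence-reverseGaps O ,
     subst₂ _<_ (sym (entry-reverseGaps-reflectFin y)) (sym (entry-reverseGaps-reflectFin z)) fb<fc)

  occurrence132⇒123 : ∀ t → IsOccurrence p132 σ t ≡ true →
                      IsOccurrence p123 (reverseGaps σ) (reverseTriple σ t) ≡ true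
  occurrence132⇒123 (x ∷ y ∷ z ∷ []) h with Equivalence.to (occurrence132⇔ σ x y z perm) h
  ... | O , fc<fb =
    Equivalence.from (occurrence123⇔ (reverseGaps σ) x (reflectFin σ z) (reflectFin σ y) (reverseGaps-perm σ perm))
    (occurrence-reverseGaps O ,
     subst₂ _<_ (sym (entry-reverseGaps-reflectFin z)) (sym (entry-reverseGaps-reflectFin y)) fc<fb)

isOccurrence-reverseGaps : ∀ {n} (σ : Vec (Fin n) n) → IsPerm σ ≡ true →
  ∀ t → IsOccurrence p123 σ t ≡ IsOccurrence p132 (reverseGaps σ) (reverseTriple σ t)
isOccurrence-reverseGaps σ perm t = ⇔→≡ (mk⇔ (occurrence123⇒132 σ perm t) back)
  where
    back : IsOccurrence p132 (reverseGaps σ) (reverseTriple σ t) ≡ true → IsOccurrence p123 σ t ≡ true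
    back h = subst₂ (λ π t′ → IsOccurrence p123 π t′ ≡ true)
               (reverseGaps-involutive σ)
               (trans (reverseTriple-reverseGaps σ (reverseTriple σ t)) (reverseTriple-involutive σ t))
               (occurrence132⇒123 (reverseGaps σ) (reverseGaps-perm σ perm) (reverseTriple σ t) h)

occ-reverseGaps : ∀ {n} (σ : Vec (Fin n) n) → IsPerm σ ≡ true → occ p123 σ ≡ occ p132 (reverseGaps σ)
occ-reverseGaps σ perm =
  count-involution (reverseTriple σ) (reverseTriple-involutive σ) (isOccurrence-reverseGaps σ perm)

theorem3p1 : mesh 3 τ123 R₃₁ ∼d mesh 3 τ132 R₃₁
theorem3p1 n ℓ = count-involution {n} {n} {Q = λ π → IsPerm π ∧ (occ p132 π ≡ᵇ ℓ)}
                   reverseGaps reverseGaps-involutive counted-alike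
  where
    counted-alike : ∀ σ → (IsPerm σ ∧ (occ p123 σ ≡ᵇ ℓ)) ≡
                          (IsPerm (reverseGaps σ) ∧ (occ p132 (reverseGaps σ) ≡ᵇ ℓ))
    counted-alike σ rewrite IsPerm-reverseGaps σ with IsPerm σ in perm
    ... | false = refl
    ... | true  = cong (_≡ᵇ ℓ) (occ-reverseGaps σ perm)
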